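{- For every integer $n\ge 2$ there exist unique integers $a=a(n)$, $b=b(n)$, $t=t(n)$ with $n=af_t+bf_{t-1}$, $t\ge 2$ and $1\le a\le b\le f_t$. Moreover: (i) $(b,a)$ is $n$-good, $s(n)=t+1$, and, writing $s=s(n)$, we have $w_{s+1}(b,a)=\lfloor \phi n\rfloor$ if $t$ is even and $w_{s+1}(b,a)=\lceil \phi n\rceil$ if $t$ is odd. (ii) If $a\le f_{t-1}$, then $(b,a)$ is the unique $n$-good pair. Otherwise, the only other $n$-good pair is $(b',a')=(b+f_t,\,a-f_{t-1})$, and $w_{s+1}(b',a')=\lfloor\phi n\rfloor-1$ if $t$ is even and $w_{s+1}(b',a')=\lceil\phi n\rceil+1$ if $t$ is odd.
   Context: $f_k$ denotes the Fibonacci numbers, $f_1=f_2=1$, $f_{k+2}=f_{k+1}+f_k$ (with $f_0=0$, $f_{ -1}=1$), and $\phi=(1+\sqrt5)/2$. For positive integers $a_1,a_2$, the $(a_1,a_2)$-Fibonacci walk is the sequence $w_k=w_k(a_1,a_2)$ with $w_1=a_1$, $w_2=a_2$, $w_{k+2}=w_{k+1}+w_k$ for $k\ge1$. Let $s(n;a_1,a_2)$ be the integer $s$ with $w_s(a_1,a_2)=n$ (and $-\infty$ if none exists), and $s(n)=\max_{a_1,a_2\ge1}s(n;a_1,a_2)$. A pair $(a_1,a_2)$ is $n$-good if $a_1,a_2\ge1$ and $s(n;a_1,a_2)=s(n)$. -}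

module Defs where

open import Data.Nat using (ℕ; zero; suc; _+_; _*_; _∸_; _≤_; _<_)
open import Data.Product using (_×_; ∃; ∃-syntax)
open import Relation.Binary.PropositionalEquality using (_≡_)

fib : ℕ → ℕ
fib zero = zero
fib (suc zero) = suc zero
fib (suc (suc k)) = fib (suc k) + fib k

-- The (a₁,a₂)-Fibonacci walk, 1-indexed: walk a₁ a₂ 1 = a₁, walk a₁ a₂ 2 = a₂,
-- walk a₁ a₂ (k+2) = walk a₁ a₂ (k+1) + walk a₁ a₂ k for k ≥ 1.
-- (Index 0 is not part of the walk; its value 0 is a dummy and never used.)
walk : ℕ → ℕ → ℕ → ℕ
walk a₁ a₂ zero = zero
walk a₁ a₂ (suc zero) = a₁
walk a₁ a₂ (suc (suc zero)) = a₂
walk a₁ a₂ (suc (suc (suc k))) = walk a₁ a₂ (suc (suc k)) + walk a₁ a₂ (suc k)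

Hits : ℕ → ℕ → ℕ → ℕ → Set
Hits a₁ a₂ n s = 1 ≤ s × walk a₁ a₂ s ≡ n

IsS : ℕ → ℕ → Set
IsS n s =
  (∃[ a₁ ] ∃[ a₂ ] (1 ≤ a₁ × 1 ≤ a₂ × Hits a₁ a₂ n s)) ×
  (∀ a₁ a₂ k → 1 ≤ a₁ → 1 ≤ a₂ → Hits a₁ a₂ n k → k ≤ s)

Good : ℕ → ℕ → ℕ → Set
Good n a₁ a₂ = 1 ≤ a₁ × 1 ≤ a₂ × ∃[ s ] (IsS n s × Hits a₁ a₂ n s)

-- Comparisons with φ·n, φ = (1+√5)/2 the positive root of x² = x + 1.
-- For naturals m, n:  m ≤ φ n  ⇔  m² ≤ m n + n².
LePhi : ℕ → ℕ → Set
LePhi m n = m * m ≤ m * n + n * n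

-- φ n < m  ⇔  m n + n² < m².
PhiLt : ℕ → ℕ → Set
PhiLt n m = m * n + n * n < m * m

IsFloorPhi : ℕ → ℕ → Set
IsFloorPhi n m = LePhi m n × PhiLt n (suc m)

-- m = ⌈φ n⌉ :  m - 1 < φ n ≤ m  (with m ≥ 1)
-- (φ n ≤ m  ⇔  m n + n² ≤ m²)
IsCeilPhi : ℕ → ℕ → Set
IsCeilPhi n m = 1 ≤ m × LePhi (m ∸ 1) n × (m * n + n * n ≤ m * m)

{-# OPTIONS --safe #-}
-- Since w_{k+2}(x, y) = x f_k + y f_{k+1}, a pair hitting n at position t + 1 is a solution of
-- y f_t + x f_{t-1} = n, and as f_t and f_{t-1} are coprime these solutions are
-- (x, y) = (b + k f_t, a − k f_{t-1}); the bounds 1 ≤ a ≤ b ≤ f_t leave only k = 0 and, when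
-- a > f_{t-1}, k = 1.  A hit at position t + 2 would be a solution with y > x, which a ≤ b
-- forbids, and later hits reduce to this one because tails of walks are walks; so s(n) = t + 1.
-- The representation itself is found by a descent on a + b.
-- For the comparison with φ n, consecutive walk terms p, q satisfy q² − qp − p² = ±(a² − ab − b²),
-- the sign alternating with the position, and Cassini's identity (the same fact for (f_{-1}, f_0))
-- shows that the second good pair changes w_{s+1} by exactly one.
module Submission where

open import Defs
open import Data.Nat using (ℕ; zero; suc; _+_; _*_; _∸_; _≤_; _<_; _%_; z≤n; s≤s; _≤?_; _<?_; >-nonZero)
open import Data.Nat.Properties
open import Data.Nat.Coprimality using (Coprime; coprime-divisor)
open import Data.Nat.Divisibility using (_∣_; divides; ∣m+n∣m⇒∣n; ∣1⇒≡1; n∣m*n)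
open import Data.Nat.Induction using (<-wellFounded)
open import Data.Nat.Tactic.RingSolver using (solve)
open import Induction.WellFounded using (Acc; acc)
open import Data.List using (_∷_; [])
open import Data.Product using (_×_; _,_; proj₁; proj₂; ∃-syntax)
open import Data.Sum using (_⊎_; inj₁; inj₂; [_,_]′; map₂)
open import Function using (_∘_)
open import Algebra.Properties.CommutativeSemigroup +-commutativeSemigroup using () renaming (interchange to +-interchange)
open import Relation.Nullary using (¬_; yes; no; contradiction)
open import Relation.Binary.PropositionalEquality

1≤fib[1+k] : ∀ k → 1 ≤ fib (suc k)
1≤fib[1+k] zero = s≤s z≤n
1≤fib[1+k] (suc k) = ≤-trans (1≤fib[1+k] k) (m≤m+n _ _)

fib[k]≤fib[1+k] : ∀ k → fib k ≤ fib (suc k)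
fib[k]≤fib[1+k] zero = z≤n
fib[k]≤fib[1+k] (suc k) = m≤m+n _ _

fib[2+k]<fib[3+k] : ∀ k → fib (suc (suc k)) < fib (suc (suc (suc k)))
fib[2+k]<fib[3+k] k = m<m+n (fib (suc (suc k))) (1≤fib[1+k] k)

fib[1+k]≤fib[k]+fib[k] : ∀ k → 1 ≤ k → fib (suc k) ≤ fib k + fib k
fib[1+k]≤fib[k]+fib[k] (suc k) _ = +-monoʳ-≤ (fib (suc k)) (fib[k]≤fib[1+k] k)

fib-coprime : ∀ k → Coprime (fib (suc k)) (fib k)
fib-coprime zero (d∣1 , _) = ∣1⇒≡1 d∣1
fib-coprime (suc k) (d∣F+f , d∣F) = fib-coprime k (d∣F , ∣m+n∣m⇒∣n d∣F+f d∣F)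

coprime-shift-∣ : ∀ {F f a b y} o → Coprime F f → a * F + b * f ≡ y * F + (b + o) * f → F ∣ o
coprime-shift-∣ {F} {f} {a} {b} {y} o F⊥f eq =
  coprime-divisor F⊥f (∣m+n∣m⇒∣n (subst (F ∣_) aF≡yF+fo (n∣m*n a)) (n∣m*n y))
  where
  aF≡yF+fo : a * F ≡ y * F + f * o
  aF≡yF+fo = +-cancelʳ-≡ (b * f) _ _ (trans eq (solve (y ∷ F ∷ b ∷ o ∷ f ∷ [])))

coprime-solutions : ∀ {F f a b x y} → Coprime F f → 1 ≤ F →
  a * F + b * f ≡ y * F + x * f → b ≤ x → ∃[ k ] (x ≡ b + k * F × a ≡ y + k * f)
coprime-solutions {F} {f} {a} {b} {y = y} F⊥f 1≤F eq b≤x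
  with o , refl ← m≤n⇒∃[o]m+o≡n b≤x
  with divides k refl ← coprime-shift-∣ {a = a} {b} {y} o F⊥f eq
  = k , refl , *-cancelʳ-≡ a (y + k * f) F {{>-nonZero 1≤F}}
                 (+-cancelʳ-≡ (b * f) _ _ (trans eq (solve (y ∷ F ∷ b ∷ k ∷ f ∷ []))))

walk-fib : ∀ x y k → walk x y (suc (suc k)) ≡ x * fib k + y * fib (suc k)
walk-fib x y zero = sym (cong₂ _+_ (*-zeroʳ x) (*-identityʳ y))
walk-fib x y (suc zero) = trans (+-comm y x) (sym (cong₂ _+_ (*-identityʳ x) (*-identityʳ y)))
walk-fib x y (suc (suc k)) = begin
  walk x y (suc (suc (suc k))) + walk x y (suc (suc k))
    ≡⟨ cong₂ _+_ (walk-fib x y (suc k)) (walk-fib x y k) ⟩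
  (x * p + y * q) + (x * r + y * p)  ≡⟨ +-interchange (x * p) (y * q) (x * r) (y * p) ⟩
  (x * p + x * r) + (y * q + y * p)  ≡⟨ sym (cong₂ _+_ (*-distribˡ-+ x p r) (*-distribˡ-+ y q p)) ⟩
  x * (p + r) + y * (q + p)          ∎
  where
  open ≡-Reasoning
  p q r : ℕ
  p = fib (suc k)
  q = fib (suc (suc k))
  r = fib k

walk-pos : ∀ {x y} k → 1 ≤ x → 1 ≤ y → 1 ≤ walk x y (suc k)
walk-pos zero 1≤x 1≤y = 1≤x
walk-pos (suc zero) 1≤x 1≤y = 1≤y
walk-pos (suc (suc k)) 1≤x 1≤y = ≤-trans (walk-pos (suc k) 1≤x 1≤y) (m≤m+n _ _)

walk-from : ∀ x y d j → walk x y (suc j + d) ≡ walk (walk x y (suc d)) (walk x y (suc (suc d))) (suc j)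
walk-from x y d zero = refl
walk-from x y d (suc zero) = refl
walk-from x y d (suc (suc j)) = cong₂ _+_ (walk-from x y d (suc j)) (walk-from x y d j)

-- Norm p q X Y says q² − qp − p² = Y − X.
Norm : ℕ → ℕ → ℕ → ℕ → Set
Norm p q X Y = q * q + X ≡ q * p + p * p + Y

norm-step : ∀ p q {X Y} → Norm p q X Y → Norm q (q + p) Y X
norm-step p q {X} {Y} norm = +-cancelʳ-≡ (q * q + X) _ _ (begin
  (q + p) * (q + p) + Y + (q * q + X)            ≡⟨ solve (p ∷ q ∷ X ∷ Y ∷ []) ⟩
  (q + p) * q + q * q + X + (q * p + p * p + Y)  ≡⟨ cong ((q + p) * q + q * q + X +_) (sym norm) ⟩
  (q + p) * q + q * q + X + (q * q + X)          ∎)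
  where open ≡-Reasoning

AlternatingNorm : ℕ → ℕ → ℕ → ℕ → ℕ → Set
AlternatingNorm k p q X Y = (k % 2 ≡ 0 → Norm p q X Y) × (k % 2 ≡ 1 → Norm p q Y X)

walk-norm : ∀ x y k →
  AlternatingNorm k (walk x y (suc k)) (walk x y (suc (suc k))) (y * x + x * x) (y * y)
walk-norm x y zero = (λ _ → +-comm (y * y) (y * x + x * x)) , λ ()
walk-norm x y (suc zero) = (λ ()) , λ _ → norm-step x y (+-comm (y * y) (y * x + x * x))
walk-norm x y (suc (suc k)) with even , odd ← walk-norm x y k = two-steps ∘ even , two-steps ∘ odd
  where
  w : ℕ → ℕ
  w i = walk x y (suc i)
  two-steps : ∀ {X Y} → Norm (w k) (w (suc k)) X Y → Norm (w (suc (suc k))) (w (suc (suc (suc k)))) X Y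
  two-steps = norm-step (w (suc k)) (w (suc (suc k))) ∘ norm-step (w k) (w (suc k))

walk-1-0≡fib : ∀ k → walk 1 0 (suc (suc k)) ≡ fib k
walk-1-0≡fib zero = refl
walk-1-0≡fib (suc zero) = refl
walk-1-0≡fib (suc (suc k)) = cong₂ _+_ (walk-1-0≡fib (suc k)) (walk-1-0≡fib k)

cassini : ∀ k → AlternatingNorm (suc k) (fib k) (fib (suc k)) 1 0
cassini k = subst₂ (λ p q → AlternatingNorm (suc k) p q 1 0) (walk-1-0≡fib k) (walk-1-0≡fib (suc k))
                   (walk-norm 1 0 (suc k))

norm⇒IsFloorPhi : ∀ n m {X Y} → Norm n m X Y → Y ≤ X → n + X ≤ m + m → IsFloorPhi n m
norm⇒IsFloorPhi n m {X} {Y} norm Y≤X n+X≤2m = m²≤ , <[m+1]²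
  where
  open ≤-Reasoning
  m²≤ : m * m ≤ m * n + n * n
  m²≤ = +-cancelʳ-≤ X _ _ (begin
    m * m + X          ≡⟨ norm ⟩
    m * n + n * n + Y  ≤⟨ +-monoʳ-≤ (m * n + n * n) Y≤X ⟩
    m * n + n * n + X  ∎)
  <[m+1]² : suc m * n + n * n < suc m * suc m
  <[m+1]² = +-cancelʳ-≤ X _ _ (begin
    suc (suc m * n + n * n) + X            ≡⟨ solve (m ∷ n ∷ X ∷ []) ⟩
    suc (m * n + n * n + (n + X))          ≤⟨ s≤s (+-monoʳ-≤ (m * n + n * n) (≤-trans n+X≤2m (m≤m+n (m + m) Y))) ⟩
    suc (m * n + n * n + (m + m + Y))      ≡⟨ solve (m ∷ n ∷ Y ∷ []) ⟩
    suc (m * n + n * n + Y + (m + m))      ≡⟨ cong (λ z → suc (z + (m + m))) (sym norm) ⟩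
    suc (m * m + X + (m + m))              ≡⟨ solve (m ∷ X ∷ []) ⟩
    suc m * suc m + X                      ∎)

norm⇒IsCeilPhi : ∀ n m {X Y} → Norm n m Y X → Y ≤ X → 1 ≤ Y → n + X ≤ m + m → IsCeilPhi n m
norm⇒IsCeilPhi n zero {X} _ Y≤X 1≤Y n+X≤0 = contradiction (≤-trans 1≤Y (≤-trans Y≤X (≤-trans (m≤n+m X n) n+X≤0))) λ ()
norm⇒IsCeilPhi n (suc m) {X} {Y} norm Y≤X 1≤Y n+X≤2m = s≤s z≤n , [m-1]²≤ , ≤m²
  where
  open ≤-Reasoning
  ≤m² : suc m * n + n * n ≤ suc m * suc m
  ≤m² = +-cancelʳ-≤ Y _ _ (begin
    suc m * n + n * n + Y  ≤⟨ +-monoʳ-≤ (suc m * n + n * n) Y≤X ⟩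
    suc m * n + n * n + X  ≡⟨ sym norm ⟩
    suc m * suc m + Y      ∎)
  [m-1]²≤ : m * m ≤ m * n + n * n
  [m-1]²≤ = +-cancelʳ-≤ (suc (m + m) + Y) _ _ (begin
    m * m + (suc (m + m) + Y)            ≡⟨ solve (m ∷ Y ∷ []) ⟩
    suc m * suc m + Y                    ≡⟨ norm ⟩
    suc m * n + n * n + X                ≡⟨ solve (m ∷ n ∷ X ∷ []) ⟩
    m * n + n * n + (n + X)              ≤⟨ +-monoʳ-≤ (m * n + n * n) (≤-trans n+X≤2m (≤-reflexive (+-suc (suc m) m))) ⟩
    m * n + n * n + suc (suc (m + m))    ≤⟨ +-monoʳ-≤ (m * n + n * n) (s≤s (m<m+n (m + m) 1≤Y)) ⟩
    m * n + n * n + (suc (m + m) + Y)    ∎)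

walk-shift-cassini : ∀ b d u {X Y} → Norm (fib u) (fib (suc u)) X Y →
  walk (b + fib (suc u)) d (suc (suc (suc u))) + X ≡ walk b (fib u + d) (suc (suc (suc u))) + Y
walk-shift-cassini b d u {X} {Y} cassini-u = begin
  walk (b + fib (suc u)) d (suc (suc (suc u))) + X  ≡⟨ cong (_+ X) (walk-fib (b + fib (suc u)) d (suc u)) ⟩
  (b + F) * F + d * (F + f) + X                     ≡⟨ shift F f cassini-u ⟩
  b * F + (f + d) * (F + f) + Y                     ≡⟨ cong (_+ Y) (sym (walk-fib b (fib u + d) (suc u))) ⟩
  walk b (fib u + d) (suc (suc (suc u))) + Y        ∎
  where
  open ≡-Reasoning
  F f : ℕ
  F = fib (suc u)
  f = fib u
  shift : ∀ F f → Norm f F X Y → (b + F) * F + d * (F + f) + X ≡ b * F + (f + d) * (F + f) + Y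
  shift F f norm = begin
    (b + F) * F + d * (F + f) + X        ≡⟨ solve (b ∷ d ∷ F ∷ f ∷ X ∷ []) ⟩
    b * F + d * (F + f) + (F * F + X)    ≡⟨ cong (b * F + d * (F + f) +_) norm ⟩
    b * F + d * (F + f) + (F * f + f * f + Y) ≡⟨ solve (b ∷ d ∷ F ∷ f ∷ Y ∷ []) ⟩
    b * F + (f + d) * (F + f) + Y        ∎

IsS-functional : ∀ {n s s'} → IsS n s → IsS n s' → s ≡ s'
IsS-functional ((x , y , 1≤x , 1≤y , hit) , bound) ((x' , y' , 1≤x' , 1≤y' , hit') , bound') =
  ≤-antisym (bound' x y _ 1≤x 1≤y hit) (bound x' y' _ 1≤x' 1≤y' hit')

-- The representation n = a f_t + b f_{t-1} of the theorem, indexed by u = t - 1.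
record Canonical (n a b u : ℕ) : Set where
  field
    n≡aF+bf : n ≡ a * fib (suc u) + b * fib u
    1≤u     : 1 ≤ u
    1≤a     : 1 ≤ a
    a≤b     : a ≤ b
    b≤F     : b ≤ fib (suc u)

-- Here t = u + 3: staying above t = 2 keeps f_t > f_{t-1}, so both steps decrease a + b.
canonical-descent : ∀ {n} a b u → Acc _<_ (a + b) → 1 ≤ a → 1 ≤ b →
  n ≡ a * fib (suc (suc (suc u))) + b * fib (suc (suc u)) → ∃[ a' ] ∃[ b' ] ∃[ u' ] Canonical n a' b' u'
canonical-descent a b u (acc rec) 1≤a 1≤b n≡ with b <? a | b ≤? fib (suc (suc (suc u)))
... | yes b<a | _ with c , refl ← m≤n⇒∃[o]m+o≡n b<a =
  canonical-descent b (suc c) (suc u) (rec smaller) 1≤b (s≤s z≤n)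
    (trans n≡ (regroup (fib (suc (suc (suc u)))) (fib (suc (suc u)))))
  where
  regroup : ∀ F f → (suc b + c) * F + b * f ≡ b * (F + f) + suc c * F
  regroup F f = solve (b ∷ c ∷ F ∷ f ∷ [])
  smaller : b + suc c < suc b + c + b
  smaller = ≤-<-trans (≤-reflexive (+-suc b c)) (s≤s (m<m+n (b + c) 1≤b))
... | no b≮a | yes b≤F = a , b , suc (suc u) ,
  record { n≡aF+bf = n≡ ; 1≤u = s≤s z≤n ; 1≤a = 1≤a ; a≤b = ≮⇒≥ b≮a ; b≤F = b≤F }
... | no _ | no b≰F with d , refl ← m≤n⇒∃[o]m+o≡n (≰⇒> b≰F) =
  canonical-descent (a + f) (suc d) u (rec smaller) (≤-trans 1≤a (m≤m+n a f)) (s≤s z≤n)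
    (trans n≡ (regroup F f))
  where
  F f : ℕ
  F = fib (suc (suc (suc u)))
  f = fib (suc (suc u))
  regroup : ∀ F f → a * F + (suc F + d) * f ≡ (a + f) * F + suc d * f
  regroup F f = solve (a ∷ d ∷ F ∷ f ∷ [])
  smaller : a + f + suc d < a + (suc F + d)
  smaller = ≤-<-trans (≤-reflexive (trans (+-assoc a f (suc d)) (cong (a +_) (+-suc f d))))
              (+-monoʳ-< a (+-monoˡ-< d (s≤s (fib[2+k]<fib[3+k] u))))

canonical-exists : ∀ n → 2 ≤ n → ∃[ a ] ∃[ b ] ∃[ u ] Canonical n a b u
canonical-exists (suc zero) (s≤s ())
canonical-exists (suc (suc zero)) _ = 1 , 1 , 1 ,
  record { n≡aF+bf = refl ; 1≤u = s≤s z≤n ; 1≤a = s≤s z≤n ; a≤b = s≤s z≤n ; b≤F = s≤s z≤n }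
canonical-exists (suc (suc (suc k))) _ =
  canonical-descent 1 (suc k) 0 (<-wellFounded _) (s≤s z≤n) (s≤s z≤n) (cong (3 +_) (sym (*-identityʳ k)))

module CanonicalProperties {n a b u : ℕ} (C : Canonical n a b u) where
  open Canonical C

  F f : ℕ
  F = fib (suc u)
  f = fib u

  1≤b : 1 ≤ b
  1≤b = ≤-trans 1≤a a≤b

  solutions : ∀ {x y} → 1 ≤ x → 1 ≤ y → n ≡ y * F + x * f → (x ≡ b × y ≡ a) ⊎ (x ≡ b + F × a ≡ y + f)
  solutions {x} {y} 1≤x 1≤y n≡yF+xf with ≤-total b x
  ... | inj₂ x≤b with coprime-solutions (fib-coprime u) (1≤fib[1+k] u) (trans (sym n≡yF+xf) n≡aF+bf) x≤b
  ...   | zero , b≡x+0 , y≡a+0 = inj₁ (sym (trans b≡x+0 (+-identityʳ x)) , trans y≡a+0 (+-identityʳ a))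
  ...   | suc k , b≡x+[1+k]F , _ =
    contradiction b≤F (<⇒≱ (subst (F <_) (sym b≡x+[1+k]F) (+-mono-≤ 1≤x (m≤m+n F (k * F)))))
  solutions {x} {y} 1≤x 1≤y n≡yF+xf | inj₁ b≤x
    with coprime-solutions (fib-coprime u) (1≤fib[1+k] u) (trans (sym n≡aF+bf) n≡yF+xf) b≤x
  ...   | zero , x≡b+0 , a≡y+0 = inj₁ (trans x≡b+0 (+-identityʳ b) , sym (trans a≡y+0 (+-identityʳ y)))
  ...   | suc zero , x≡b+1F , a≡y+1f =
    inj₂ (trans x≡b+1F (cong (b +_) (+-identityʳ F)) , trans a≡y+1f (cong (y +_) (+-identityʳ f)))
  ...   | suc (suc k) , _ , a≡y+[2+k]f = contradiction a≤b (<⇒≱ b<a)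
    where
    b<a : b < a
    b<a = subst (b <_) (sym a≡y+[2+k]f)
            (≤-trans (s≤s (≤-trans b≤F (fib[1+k]≤fib[k]+fib[k] u 1≤u)))
                     (+-mono-≤ 1≤y (+-monoʳ-≤ f (m≤m+n f (k * f)))))

  no-hit-at-s+1 : ∀ {x y} → 1 ≤ x → 1 ≤ y → walk x y (suc (suc (suc u))) ≢ n
  no-hit-at-s+1 {x} {y} 1≤x 1≤y hit = [ first , second ]′ (solutions 1≤y 1≤x+y n≡[x+y]F+yf)
    where
    1≤x+y : 1 ≤ x + y
    1≤x+y = ≤-trans 1≤x (m≤m+n x y)
    n≡[x+y]F+yf : n ≡ (x + y) * F + y * f
    n≡[x+y]F+yf = trans (sym hit) (trans (walk-fib x y (suc u)) (regroup F f))
      where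
      regroup : ∀ F f → x * F + y * (F + f) ≡ (x + y) * F + y * f
      regroup F f = solve (x ∷ y ∷ F ∷ f ∷ [])
    first : ¬ (y ≡ b × x + y ≡ a)
    first (y≡b , x+y≡a) = <⇒≱ (m<n+m y 1≤x) (subst₂ _≤_ (sym x+y≡a) (sym y≡b) a≤b)
    second : ¬ (y ≡ b + F × a ≡ x + y + f)
    second (y≡b+F , a≡x+y+f) = <⇒≱ (≤-<-trans b≤y y<a) a≤b
      where
      b≤y : b ≤ y
      b≤y = subst (b ≤_) (sym y≡b+F) (m≤m+n b F)
      y<a : y < a
      y<a = subst (y <_) (sym a≡x+y+f) (<-≤-trans (m<n+m y 1≤x) (m≤m+n (x + y) f))

  hit-position≤s : ∀ {x y k} → 1 ≤ x → 1 ≤ y → Hits x y n k → k ≤ suc (suc u)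
  hit-position≤s {x} {y} {k} 1≤x 1≤y (_ , hit) with k ≤? suc (suc u)
  ... | yes k≤s = k≤s
  ... | no k≰s with d , refl ← m≤n⇒∃[o]m+o≡n (≰⇒> k≰s) =
    contradiction (trans (sym (walk-from x y d (suc (suc u)))) hit)
                  (no-hit-at-s+1 (walk-pos d 1≤x 1≤y) (walk-pos (suc d) 1≤x 1≤y))

  walk-at-s : ∀ x y → walk x y (suc (suc u)) ≡ y * F + x * f
  walk-at-s x y = trans (walk-fib x y u) (+-comm (x * f) (y * F))

  s≡t+1 : IsS n (suc (suc u))
  s≡t+1 = (b , a , 1≤b , 1≤a , s≤s z≤n , trans (walk-at-s b a) (sym n≡aF+bf)) ,
          λ x y k 1≤x 1≤y → hit-position≤s 1≤x 1≤y

  solution⇒good : ∀ {x y} → 1 ≤ x → 1 ≤ y → n ≡ y * F + x * f → Good n x y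
  solution⇒good {x} {y} 1≤x 1≤y n≡ = 1≤x , 1≤y , suc (suc u) , s≡t+1 , s≤s z≤n , trans (walk-at-s x y) (sym n≡)

  good-pairs : ∀ x y → Good n x y → (x ≡ b × y ≡ a) ⊎ (x ≡ b + F × y ≡ a ∸ f)
  good-pairs x y (1≤x , 1≤y , s , s-is , _ , hit) with refl ← IsS-functional s-is s≡t+1 =
    map₂ (λ (x≡b+F , a≡y+f) → x≡b+F , sym (trans (cong (_∸ f) a≡y+f) (m+n∸n≡m y f)))
         (solutions 1≤x 1≤y (trans (sym hit) (walk-at-s x y)))

  good-canonical : Good n b a
  good-canonical = solution⇒good 1≤b 1≤a n≡aF+bf

  only-good-pair : a ≤ f → ∀ x y → Good n x y → x ≡ b × y ≡ a
  only-good-pair a≤f x y g@(_ , 1≤y , _) with good-pairs x y g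
  ... | inj₁ canonical = canonical
  ... | inj₂ (_ , y≡a∸f) = contradiction (trans y≡a∸f (m≤n⇒m∸n≡0 a≤f)) (m<n⇒n≢0 1≤y)

  second-good : f < a → Good n (b + F) (a ∸ f)
  second-good f<a = solution⇒good (≤-trans 1≤b (m≤m+n b F)) (m<n⇒0<n∸m f<a) (begin
    n                          ≡⟨ n≡aF+bf ⟩
    a * F + b * f              ≡⟨ cong (λ z → z * F + b * f) (sym (m+[n∸m]≡n (<⇒≤ f<a))) ⟩
    (f + (a ∸ f)) * F + b * f  ≡⟨ regroup F f (a ∸ f) ⟩
    (a ∸ f) * F + (b + F) * f  ∎)
    where
    open ≡-Reasoning
    regroup : ∀ F f d → (f + d) * F + b * f ≡ d * F + (b + F) * f
    regroup F f d = solve (b ∷ F ∷ f ∷ d ∷ [])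

  next : ℕ
  next = walk b a (suc (suc (suc u)))

  next-norm : AlternatingNorm (suc u) n next (a * b + b * b) (a * a)
  next-norm = subst (λ p → AlternatingNorm (suc u) p next (a * b + b * b) (a * a))
                    (trans (walk-at-s b a) (sym n≡aF+bf)) (walk-norm b a (suc u))

  a²≤ab+b² : a * a ≤ a * b + b * b
  a²≤ab+b² = ≤-trans (*-monoʳ-≤ a a≤b) (m≤m+n (a * b) (b * b))

  n+ab+b²≤2next : n + (a * b + b * b) ≤ next + next
  n+ab+b²≤2next = begin
    n + (a * b + b * b)                      ≡⟨ cong (_+ (a * b + b * b)) n≡aF+bf ⟩
    a * F + b * f + (a * b + b * b)          ≤⟨ +-mono-≤ (+-monoʳ-≤ (a * F) (*-monoʳ-≤ b (fib[k]≤fib[1+k] u)))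
                                                         (+-mono-≤ (*-monoʳ-≤ a b≤F) (*-monoʳ-≤ b b≤F)) ⟩
    a * F + b * F + (a * F + b * F)          ≤⟨ m≤m+n _ (a * f + a * f) ⟩
    a * F + b * F + (a * F + b * F) + (a * f + a * f)  ≡⟨ regroup F f ⟩
    (b * F + a * (F + f)) + (b * F + a * (F + f))      ≡⟨ sym (cong₂ _+_ (walk-fib b a (suc u)) (walk-fib b a (suc u))) ⟩
    next + next                              ∎
    where
    open ≤-Reasoning
    regroup : ∀ F f → a * F + b * F + (a * F + b * F) + (a * f + a * f) ≡ (b * F + a * (F + f)) + (b * F + a * (F + f))
    regroup F f = solve (a ∷ b ∷ F ∷ f ∷ [])

  next-floor : suc u % 2 ≡ 0 → IsFloorPhi n next
  next-floor even = norm⇒IsFloorPhi n next (proj₁ next-norm even) a²≤ab+b² n+ab+b²≤2next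

  next-ceil : suc u % 2 ≡ 1 → IsCeilPhi n next
  next-ceil odd = norm⇒IsCeilPhi n next (proj₂ next-norm odd) a²≤ab+b² (*-mono-≤ 1≤a 1≤a) n+ab+b²≤2next

  second-next : ∀ {X Y} → Norm f F X Y → f ≤ a → walk (b + F) (a ∸ f) (suc (suc (suc u))) + X ≡ next + Y
  second-next {X} {Y} cassini-u f≤a =
    subst (λ z → walk (b + F) (a ∸ f) (suc (suc (suc u))) + X ≡ walk b z (suc (suc (suc u))) + Y)
          (m+[n∸m]≡n f≤a) (walk-shift-cassini b (a ∸ f) u cassini-u)

  second-floor : f < a → suc u % 2 ≡ 0 → IsFloorPhi n (walk (b + F) (a ∸ f) (suc (suc (suc u))) + 1)
  second-floor f<a even = subst (IsFloorPhi n)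
    (sym (trans (second-next (proj₁ (cassini u) even) (<⇒≤ f<a)) (+-identityʳ next))) (next-floor even)

  second-ceil : f < a → suc u % 2 ≡ 1 → IsCeilPhi n (walk (b + F) (a ∸ f) (suc (suc (suc u))) ∸ 1)
  second-ceil f<a odd = subst (IsCeilPhi n) (sym w∸1≡next) (next-ceil odd)
    where
    w : ℕ
    w = walk (b + F) (a ∸ f) (suc (suc (suc u)))
    w∸1≡next : w ∸ 1 ≡ next
    w∸1≡next = trans (cong (_∸ 1) (trans (sym (+-identityʳ w)) (second-next (proj₂ (cassini u) odd) (<⇒≤ f<a))))
                     (m+n∸n≡m next 1)

canonical-unique : ∀ {n a b u a' b' u'} → Canonical n a b u → Canonical n a' b' u' → a' ≡ a × b' ≡ b × u' ≡ u
canonical-unique {u = u} C C'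
  with refl ← suc-injective (suc-injective (IsS-functional (CanonicalProperties.s≡t+1 C') (CanonicalProperties.s≡t+1 C)))
  with CanonicalProperties.solutions C (CanonicalProperties.1≤b C') (Canonical.1≤a C') (Canonical.n≡aF+bf C')
... | inj₁ (b'≡b , a'≡a) = a'≡a , b'≡b , refl
... | inj₂ (b'≡b+F , _) = contradiction (Canonical.b≤F C')
  (<⇒≱ (subst (fib (suc u) <_) (sym b'≡b+F) (m<n+m (fib (suc u)) (CanonicalProperties.1≤b C))))

representation-unique : ∀ {n a b u} → Canonical n a b u →
  ∀ a' b' t' → n ≡ a' * fib t' + b' * fib (t' ∸ 1) → 2 ≤ t' → 1 ≤ a' → a' ≤ b' → b' ≤ fib t' →
  a' ≡ a × b' ≡ b × t' ≡ suc u
representation-unique C a' b' (suc u') n≡ (s≤s 1≤u') 1≤a' a'≤b' b'≤F'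
  with a'≡a , b'≡b , refl ← canonical-unique C
         (record { n≡aF+bf = n≡ ; 1≤u = 1≤u' ; 1≤a = 1≤a' ; a≤b = a'≤b' ; b≤F = b'≤F' })
  = a'≡a , b'≡b , refl

theorem1 : ∀ n → 2 ≤ n →
    ∃[ a ] ∃[ b ] ∃[ t ]
      ( (n ≡ a * fib t + b * fib (t ∸ 1) × 2 ≤ t × 1 ≤ a × a ≤ b × b ≤ fib t)
      × (∀ a' b' t' → n ≡ a' * fib t' + b' * fib (t' ∸ 1) → 2 ≤ t' → 1 ≤ a' → a' ≤ b' → b' ≤ fib t'
           → a' ≡ a × b' ≡ b × t' ≡ t)
      × (Good n b a × IsS n (suc t)
         × (t % 2 ≡ 0 → IsFloorPhi n (walk b a (suc (suc t))))
         × (t % 2 ≡ 1 → IsCeilPhi n (walk b a (suc (suc t)))))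
      × ((a ≤ fib (t ∸ 1) → ∀ x y → Good n x y → x ≡ b × y ≡ a)
         × (fib (t ∸ 1) < a →
              Good n (b + fib t) (a ∸ fib (t ∸ 1))
              × (∀ x y → Good n x y → (x ≡ b × y ≡ a) ⊎ (x ≡ b + fib t × y ≡ a ∸ fib (t ∸ 1)))
              × (t % 2 ≡ 0 → IsFloorPhi n (walk (b + fib t) (a ∸ fib (t ∸ 1)) (suc (suc t)) + 1))
              × (t % 2 ≡ 1 → IsCeilPhi n (walk (b + fib t) (a ∸ fib (t ∸ 1)) (suc (suc t)) ∸ 1)))))
theorem1 n 2≤n with a , b , u , C ← canonical-exists n 2≤n =
  a , b , suc u ,
  (n≡aF+bf , s≤s 1≤u , 1≤a , a≤b , b≤F) ,
  representation-unique C ,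
  (good-canonical , s≡t+1 , next-floor , next-ceil) ,
  (only-good-pair , λ f<a → second-good f<a , good-pairs , second-floor f<a , second-ceil f<a)
  where
  open Canonical C
  open CanonicalProperties C
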